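{- Let $n,k,t$ be positive integers with $t<k$, and let $\mathcal{F} \subset \binom{[n]}{k}$ be a $k$-partite family with respect to a partition $[n]=X_1\sqcup\dots\sqcup X_k$. Suppose that $|\mathcal{F}| > \binom{n}{k-t-2}$. Then $r(\operatorname{Int}(\mathcal{F})) \geqslant k-t-1$.
   Context: A family $\mathcal{F}\subset\binom{[n]}{k}$ is $k$-partite with respect to a partition $[n]=X_1\sqcup\dots\sqcup X_k$ if $|F\cap X_i|=1$ for every $F\in\mathcal{F}$ and $i\in[k]$. For $Y\subset[n]$ let $\pi(Y)=\{i\in[k]: Y\cap X_i\neq\emptyset\}$. The intersection structure is $\operatorname{Int}(\mathcal{F})=\{\pi(E\cap F): E,F\in\mathcal{F}, E\neq F\}\subset 2^{[k]}$. A family $\mathcal{M}\subset 2^{[k]}$ covers a set $A$ if $A\subset M$ for some $M\in\mathcal{M}$; the rank $r(\mathcal{M})$ is the size of the smallest set in $2^{[k]}$ not covered by $\mathcal{M}\setminus\{[k]\}$. Binomial coefficients with negative lower index are $0$. -}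

module Defs where

open import Data.Nat using (ℕ; _∸_; _≤?_; suc)
open import Data.Nat.Combinatorics using (_C_)
open import Data.Fin using (Fin; _≟_)
open import Data.Fin.Properties using (any?)
open import Data.Fin.Subset using (Subset; _∈_; _∩_; _⊆_; ∣_∣; ⊤; inside; outside)
open import Data.Fin.Subset.Properties using (_∈?_)
open import Data.Vec using (tabulate)
open import Data.List using (List)
open import Data.List.Membership.Propositional renaming (_∈_ to _∈ₗ_)
open import Data.Product using (Σ; ∃; _×_; _,_)
open import Relation.Binary.PropositionalEquality using (_≡_; _≢_)
open import Relation.Nullary using (Dec; yes; no; does)
open import Relation.Nullary.Decidable using (_×-dec_)
open import Data.Bool using (if_then_else_)

-- A partition [n] = X_1 ⊔ ... ⊔ X_k is encoded by the map  part : Fin n → Fin k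
-- sending an element to the index of its block: X_i = { x | part x ≡ i }.

block : ∀ {n k} → (Fin n → Fin k) → Fin k → Subset n
block part i = tabulate (λ x → if does (part x ≟ i) then inside else outside)

π : ∀ {n k} → (Fin n → Fin k) → Subset n → Subset k
π {n} part Y = tabulate λ i →
  if does (any? (λ x → (x ∈? Y) ×-dec (part x ≟ i))) then inside else outside

KPartiteSet : ∀ {n k} → (Fin n → Fin k) → Subset n → Set
KPartiteSet {k = k} part F = ∣ F ∣ ≡ k × (∀ i → ∣ F ∩ block part i ∣ ≡ 1)

InInt : ∀ {n k} → (Fin n → Fin k) → List (Subset n) → Subset k → Set
InInt part 𝓕 M = Σ _ λ E → Σ _ λ F →
  E ∈ₗ 𝓕 × F ∈ₗ 𝓕 × E ≢ F × π part (E ∩ F) ≡ M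

CoveredBy : ∀ {k} → (Subset k → Set) → Subset k → Set
CoveredBy 𝓜 A = Σ _ λ M → 𝓜 M × M ≢ ⊤ × A ⊆ M

-- r(𝓜) ≥ m : the smallest subset of [k] not covered by 𝓜 \ {[k]} has size ≥ m,
-- i.e. every subset of size < m is covered by 𝓜 \ {[k]}.
-- (The minimum always exists since [k] itself is never so covered.)
RankAtLeast : ∀ {k} → (Subset k → Set) → ℕ → Set
RankAtLeast {k} 𝓜 m = ∀ (A : Subset k) → suc ∣ A ∣ Data.Nat.≤ m → CoveredBy 𝓜 A

-- binomial coefficient  n choose (k - t - 2), which is 0 when k - t - 2 < 0
binomShift : ℕ → ℕ → ℕ → ℕ
binomShift n k t with suc (suc t) ≤? k
... | yes _ = n C (k ∸ t ∸ 2)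
... | no _  = 0

{-# OPTIONS --safe #-}
module Submission where

-- Put s = k − t − 2 and take A ⊆ [k] with |A| ≤ s; enlarge it to a set B of exactly s
-- blocks. The trace F ∩ ⋃_{i∈B} X_i of a k-partite F is an s-subset of [n] (count it
-- block by block), so since |𝓕| > C(n,s) there are E ≠ F in 𝓕 with the same trace.
-- Then E ∩ F meets every block of B, i.e. A ⊆ B ⊆ π(E ∩ F). And π(E ∩ F) ≠ [k]: if
-- E ∩ F met every block then, E having one element per block, E ⊆ F, and symmetrically
-- F ⊆ E. If t + 2 > k then k − t − 1 = 0 and there is nothing to prove.

open import Defs
open import Data.Nat using (ℕ; _<_; _∸_; NonZero)
open import Data.Fin using (Fin)
open import Data.Fin.Subset using (Subset)
open import Data.List using (List; length)
open import Data.List.Relation.Unary.All using (All)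
open import Data.List.Relation.Unary.Unique.Propositional using (Unique)

open import Level using (Level)
open import Function using (_∘_; id)
open import Data.Bool using (Bool; true; false; _∧_; if_then_else_)
open import Data.Bool.Properties using (∧-comm; ∧-identityʳ; ∧-zeroʳ)
open import Data.Nat using (zero; suc; _+_; _*_; _≤_; s≤s; _≤?_)
open import Data.Nat.Properties
  using (+-0-commutativeMonoid; +-identityʳ; *-identityʳ; +-comm; +-suc; suc-injective;
         ≤-trans; ≤-reflexive; ≤-pred; ≰⇒>; 1+n≰n; m∸n≤m; ∸-monoˡ-≤; m+n∸n≡m; m+[n∸m]≡n; m≤n+m∸n)
open import Data.Nat.Combinatorics using (_C_; nCk+nC[k+1]≡[n+1]C[k+1])
open import Data.Fin using (zero; suc; _≟_) renaming (_<_ to _<ᶠ_)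
open import Data.Fin.Properties using (pigeonhole; any?)
open import Data.Fin.Subset using (_∈_; _∩_; _⊆_; ∣_∣; ⊤; inside; outside; Nonempty)
open import Data.Fin.Subset.Properties
  using (_∈?_; ∈⊤; ∣⊥∣≡0; ∣⁅x⁆∣≡1; x∈⁅y⁆⇒x≡y; p⊆q⇒∣p∣≤∣q∣; ⊆-antisym; ⊆-trans; s⊆s; out⊆;
         ∩-comm; x∈p∩q⁺; x∈p∩q⁻; x∈p⇒∣p-x∣<∣p∣; x∈p∧x≢y⇒x∈p-y; nonempty?; Empty-unique)
open import Data.Vec using ([]; _∷_; lookup; tabulate)
open import Data.Vec.Properties using (lookup-zipWith; lookup∘tabulate; []=⇒lookup; lookup⇒[]=)
open import Data.List using ([]; _∷_; map; _++_)
import Data.List as List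
open import Data.List.Properties using (length-map; length-++)
open import Data.List.Membership.Propositional using () renaming (_∈_ to _∈ₗ_)
open import Data.List.Membership.Propositional.Properties using (∈-map⁺; ∈-++⁺ˡ; ∈-++⁺ʳ; ∈-lookup)
open import Data.List.Relation.Unary.Any using (here; index)
open import Data.List.Relation.Unary.Any.Properties using (lookup-index)
import Data.List.Relation.Unary.All as All
open import Data.List.Relation.Unary.AllPairs using (_∷_)
open import Data.Product using (∃; ∃₂; _×_; _,_; proj₁; proj₂)
open import Relation.Binary.PropositionalEquality
open import Relation.Nullary using (yes; no; does; contradiction)
open import Relation.Nullary.Decidable using (dec-true; _×-dec_)
open import Relation.Unary using (Pred; Decidable)

open import Algebra.Properties.CommutativeMonoid.Sum +-0-commutativeMonoid
  using (sum-syntax; ∑-comm; sum-cong-≗; sum-replicate-zero)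

private
  variable
    ℓ : Level
    n k : ℕ

⟦_⟧ : Bool → ℕ
⟦ true ⟧ = 1
⟦ false ⟧ = 0

count : (Fin n → Bool) → ℕ
count {n} f = ∑[ x < n ] ⟦ f x ⟧

count-cong : {f g : Fin n → Bool} → (∀ x → f x ≡ g x) → count f ≡ count g
count-cong f≗g = sum-cong-≗ (cong ⟦_⟧ ∘ f≗g)

count-≟ : (j : Fin k) → count (λ i → does (j ≟ i)) ≡ 1
count-≟ {suc k} zero = cong suc (sum-replicate-zero k)
count-≟ (suc j) = count-≟ j

count-∧ : (b : Bool) (f : Fin n → Bool) → count (λ x → b ∧ f x) ≡ ⟦ b ⟧ * count f
count-∧ true f = sym (+-identityʳ (count f))
count-∧ {n} false f = sum-replicate-zero n

count-fibres : (p : Fin n → Fin k) (f : Fin n → Bool) →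
  count f ≡ ∑[ i < k ] count (λ x → f x ∧ does (p x ≟ i))
count-fibres {n} {k} p f = begin
  count f                                          ≡⟨ sum-cong-≗ (sym ∘ fibre) ⟩
  ∑[ x < n ] ∑[ i < k ] ⟦ f x ∧ does (p x ≟ i) ⟧   ≡⟨ ∑-comm (λ x i → ⟦ f x ∧ does (p x ≟ i) ⟧) ⟩
  ∑[ i < k ] count (λ x → f x ∧ does (p x ≟ i))    ∎
  where
  open ≡-Reasoning
  fibre : ∀ x → ∑[ i < k ] ⟦ f x ∧ does (p x ≟ i) ⟧ ≡ ⟦ f x ⟧
  fibre x = begin
    ∑[ i < k ] ⟦ f x ∧ does (p x ≟ i) ⟧    ≡⟨ count-∧ (f x) (λ i → does (p x ≟ i)) ⟩
    ⟦ f x ⟧ * count (λ i → does (p x ≟ i)) ≡⟨ cong (⟦ f x ⟧ *_) (count-≟ (p x)) ⟩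
    ⟦ f x ⟧ * 1                            ≡⟨ *-identityʳ ⟦ f x ⟧ ⟩
    ⟦ f x ⟧                                ∎

∣p∣≡count : (p : Subset n) → ∣ p ∣ ≡ count (lookup p)
∣p∣≡count [] = refl
∣p∣≡count (inside ∷ p) = cong suc (∣p∣≡count p)
∣p∣≡count (outside ∷ p) = ∣p∣≡count p

-- Both block and π are of this form, definitionally.
decSubset : {P : Pred (Fin n) ℓ} → Decidable P → Subset n
decSubset P? = tabulate (λ x → if does (P? x) then inside else outside)

lookup-decSubset : {P : Pred (Fin n) ℓ} (P? : Decidable P) (x : Fin n) →
  lookup (decSubset P?) x ≡ does (P? x)
lookup-decSubset P? x = trans (lookup∘tabulate _ x) (if-true-false (does (P? x)))
  where
  if-true-false : ∀ b → (if b then true else false) ≡ b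
  if-true-false true = refl
  if-true-false false = refl

∈-decSubset⁺ : {P : Pred (Fin n) ℓ} (P? : Decidable P) {x : Fin n} → P x → x ∈ decSubset P?
∈-decSubset⁺ P? {x} Px = lookup⇒[]= x _ (trans (lookup-decSubset P? x) (dec-true (P? x) Px))

∈-decSubset⁻ : {P : Pred (Fin n) ℓ} (P? : Decidable P) {x : Fin n} → x ∈ decSubset P? → P x
∈-decSubset⁻ P? {x} x∈ with P? x | trans (sym (lookup-decSubset P? x)) ([]=⇒lookup x∈)
... | yes Px | _ = Px
... | no _ | ()

x∈p⇒0<∣p∣ : {p : Subset n} {x : Fin n} → x ∈ p → 0 < ∣ p ∣
x∈p⇒0<∣p∣ {x = x} x∈p = subst (_≤ _) (∣⁅x⁆∣≡1 x)
  (p⊆q⇒∣p∣≤∣q∣ (λ y∈⁅x⁆ → subst (_∈ _) (sym (x∈⁅y⁆⇒x≡y x y∈⁅x⁆)) x∈p))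

0<∣p∣⇒Nonempty : {p : Subset n} → 0 < ∣ p ∣ → Nonempty p
0<∣p∣⇒Nonempty {n} {p} 0<∣p∣ with nonempty? p
... | yes ne = ne
... | no ¬ne = contradiction (subst (0 <_) (trans (cong ∣_∣ (Empty-unique ¬ne)) (∣⊥∣≡0 n)) 0<∣p∣) λ ()

∣p∣≤1⇒x≡y : {p : Subset n} {x y : Fin n} → ∣ p ∣ ≤ 1 → x ∈ p → y ∈ p → x ≡ y
∣p∣≤1⇒x≡y {x = x} {y} ∣p∣≤1 x∈p y∈p with x ≟ y
... | yes x≡y = x≡y
... | no x≢y = contradiction
  (≤-trans (s≤s (x∈p⇒0<∣p∣ (x∈p∧x≢y⇒x∈p-y y∈p (x≢y ∘ sym)))) (≤-trans (x∈p⇒∣p-x∣<∣p∣ x∈p) ∣p∣≤1))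
  1+n≰n

module _ (p : Fin n → Fin k) where

  lookup-block : ∀ i x → lookup (block p i) x ≡ does (p x ≟ i)
  lookup-block i = lookup-decSubset (λ x → p x ≟ i)

  ∈-block⁺ : ∀ {i x} → p x ≡ i → x ∈ block p i
  ∈-block⁺ {i} = ∈-decSubset⁺ (λ x → p x ≟ i)

  ∈-block⁻ : ∀ {i x} → x ∈ block p i → p x ≡ i
  ∈-block⁻ {i} = ∈-decSubset⁻ (λ x → p x ≟ i)

  meets? : (Y : Subset n) → Decidable (λ i → ∃ λ x → x ∈ Y × p x ≡ i)
  meets? Y i = any? (λ x → (x ∈? Y) ×-dec (p x ≟ i))

  ∈-π⁺ : ∀ {Y x} → x ∈ Y → p x ∈ π p Y
  ∈-π⁺ {Y} {x} x∈Y = ∈-decSubset⁺ (meets? Y) (x , x∈Y , refl)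

  ∈-π⁻ : ∀ {Y i} → i ∈ π p Y → ∃ λ x → x ∈ Y × p x ≡ i
  ∈-π⁻ {Y} = ∈-decSubset⁻ (meets? Y)

  preimage : Subset k → Subset n
  preimage B = tabulate (lookup B ∘ p)

  ∈-preimage⁺ : ∀ {B x} → p x ∈ B → x ∈ preimage B
  ∈-preimage⁺ {B} {x} px∈B = lookup⇒[]= x _ (trans (lookup∘tabulate _ x) ([]=⇒lookup px∈B))

  count-block : ∀ {F} → KPartiteSet p F → ∀ i → count (λ x → lookup F x ∧ does (p x ≟ i)) ≡ 1
  count-block {F} (_ , ∣F∩X∣≡1) i = begin
    count (λ x → lookup F x ∧ does (p x ≟ i)) ≡⟨ count-cong lookup-F∩X ⟨
    count (lookup (F ∩ block p i))             ≡⟨ ∣p∣≡count (F ∩ block p i) ⟨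
    ∣ F ∩ block p i ∣                          ≡⟨ ∣F∩X∣≡1 i ⟩
    1                                          ∎
    where
    open ≡-Reasoning
    lookup-F∩X : ∀ x → lookup (F ∩ block p i) x ≡ (lookup F x ∧ does (p x ≟ i))
    lookup-F∩X x = trans (lookup-zipWith _∧_ x F (block p i)) (cong (lookup F x ∧_) (lookup-block i x))

  ∣F∩preimage∣≡∣B∣ : ∀ {F} → KPartiteSet p F → ∀ B → ∣ F ∩ preimage B ∣ ≡ ∣ B ∣
  ∣F∩preimage∣≡∣B∣ {F} kF B = begin
    ∣ F ∩ preimage B ∣                                          ≡⟨ ∣p∣≡count (F ∩ preimage B) ⟩
    count (lookup (F ∩ preimage B))                             ≡⟨ count-cong lookup-F∩preimage ⟩
    count (λ x → lookup F x ∧ lookup B (p x))                   ≡⟨ count-fibres p _ ⟩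
    ∑[ i < k ] count (λ x → (lookup F x ∧ lookup B (p x)) ∧ does (p x ≟ i))
      ≡⟨ sum-cong-≗ (λ i → count-cong (λ x → fibre-swap (lookup F x) (p x) i)) ⟩
    ∑[ i < k ] count (λ x → lookup B i ∧ (lookup F x ∧ does (p x ≟ i)))
      ≡⟨ sum-cong-≗ (λ i → count-∧ (lookup B i) (λ x → lookup F x ∧ does (p x ≟ i))) ⟩
    ∑[ i < k ] (⟦ lookup B i ⟧ * count (λ x → lookup F x ∧ does (p x ≟ i)))
      ≡⟨ sum-cong-≗ (λ i → trans (cong (⟦ lookup B i ⟧ *_) (count-block {F} kF i)) (*-identityʳ _)) ⟩
    count (lookup B)                                            ≡⟨ ∣p∣≡count B ⟨
    ∣ B ∣                                                       ∎
    where
    open ≡-Reasoning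
    lookup-F∩preimage : ∀ x → lookup (F ∩ preimage B) x ≡ (lookup F x ∧ lookup B (p x))
    lookup-F∩preimage x =
      trans (lookup-zipWith _∧_ x F (preimage B)) (cong (lookup F x ∧_) (lookup∘tabulate _ x))
    fibre-swap : ∀ a j i → ((a ∧ lookup B j) ∧ does (j ≟ i)) ≡ (lookup B i ∧ (a ∧ does (j ≟ i)))
    fibre-swap a j i with j ≟ i
    ... | yes refl = trans (∧-identityʳ _) (trans (∧-comm a _) (cong (lookup B j ∧_) (sym (∧-identityʳ a))))
    ... | no _ = trans (∧-zeroʳ _) (sym (trans (cong (lookup B i ∧_) (∧-zeroʳ a)) (∧-zeroʳ _)))

  kpartite-injective : ∀ {F x y} → KPartiteSet p F → x ∈ F → y ∈ F → p x ≡ p y → x ≡ y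
  kpartite-injective {F} {y = y} (_ , ∣F∩X∣≡1) x∈F y∈F px≡py =
    ∣p∣≤1⇒x≡y (≤-reflexive (∣F∩X∣≡1 (p y)))
      (x∈p∩q⁺ (x∈F , ∈-block⁺ px≡py)) (x∈p∩q⁺ (y∈F , ∈-block⁺ refl))

  π[E∩F]≡⊤⇒E⊆F : ∀ {E F} → KPartiteSet p E → π p (E ∩ F) ≡ ⊤ → E ⊆ F
  π[E∩F]≡⊤⇒E⊆F {E} {F} kE π≡⊤ {x} x∈E with ∈-π⁻ (subst (p x ∈_) (sym π≡⊤) ∈⊤)
  ... | y , y∈E∩F , py≡px = subst (_∈ F) y≡x (proj₂ (x∈p∩q⁻ E F y∈E∩F))
    where
    y≡x : y ≡ x
    y≡x = kpartite-injective {E} kE (proj₁ (x∈p∩q⁻ E F y∈E∩F)) x∈E py≡px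

  π[E∩F]≢⊤ : ∀ {E F} → KPartiteSet p E → KPartiteSet p F → E ≢ F → π p (E ∩ F) ≢ ⊤
  π[E∩F]≢⊤ {E} {F} kE kF E≢F π≡⊤ = E≢F (⊆-antisym
    (π[E∩F]≡⊤⇒E⊆F {E} kE π≡⊤)
    (π[E∩F]≡⊤⇒E⊆F {F} kF (trans (cong (π p) (∩-comm F E)) π≡⊤)))

  equal-traces⇒B⊆π[E∩F] : ∀ {E F B} → KPartiteSet p E →
    E ∩ preimage B ≡ F ∩ preimage B → B ⊆ π p (E ∩ F)
  equal-traces⇒B⊆π[E∩F] {E} {F} {B} (_ , ∣E∩X∣≡1) traces≡ {i} i∈B
    with x , x∈E∩Xᵢ ← 0<∣p∣⇒Nonempty (≤-reflexive (sym (∣E∩X∣≡1 i))) =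
    subst (_∈ π p (E ∩ F)) px≡i (∈-π⁺ (x∈p∩q⁺ (x∈E , x∈F)))
    where
    x∈E : x ∈ E
    x∈E = proj₁ (x∈p∩q⁻ E (block p i) x∈E∩Xᵢ)
    px≡i : p x ≡ i
    px≡i = ∈-block⁻ (proj₂ (x∈p∩q⁻ E (block p i) x∈E∩Xᵢ))
    x∈E∩preimage : x ∈ E ∩ preimage B
    x∈E∩preimage = x∈p∩q⁺ (x∈E , ∈-preimage⁺ (subst (_∈ B) (sym px≡i) i∈B))
    x∈F : x ∈ F
    x∈F = proj₁ (x∈p∩q⁻ F (preimage B) (subst (x ∈_) traces≡ x∈E∩preimage))

subsetsOfSize : (n s : ℕ) → List (Subset n)
subsetsOfSize zero zero = [] ∷ []
subsetsOfSize zero (suc s) = []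
subsetsOfSize (suc n) zero = map (outside ∷_) (subsetsOfSize n zero)
subsetsOfSize (suc n) (suc s) =
  map (outside ∷_) (subsetsOfSize n (suc s)) ++ map (inside ∷_) (subsetsOfSize n s)

length-subsetsOfSize : ∀ n s → length (subsetsOfSize n s) ≡ n C s
length-subsetsOfSize zero zero = refl
length-subsetsOfSize zero (suc s) = refl
length-subsetsOfSize (suc n) zero =
  trans (length-map _ (subsetsOfSize n zero)) (length-subsetsOfSize n zero)
length-subsetsOfSize (suc n) (suc s) = begin
  length (map (outside ∷_) (subsetsOfSize n (suc s)) ++ map (inside ∷_) (subsetsOfSize n s))
    ≡⟨ length-++ (map (outside ∷_) (subsetsOfSize n (suc s))) ⟩
  length (map (outside ∷_) (subsetsOfSize n (suc s))) + length (map (inside ∷_) (subsetsOfSize n s))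
    ≡⟨ cong₂ _+_ (length-map _ (subsetsOfSize n (suc s))) (length-map _ (subsetsOfSize n s)) ⟩
  length (subsetsOfSize n (suc s)) + length (subsetsOfSize n s)
    ≡⟨ cong₂ _+_ (length-subsetsOfSize n (suc s)) (length-subsetsOfSize n s) ⟩
  n C suc s + n C s
    ≡⟨ +-comm (n C suc s) (n C s) ⟩
  n C s + n C suc s
    ≡⟨ nCk+nC[k+1]≡[n+1]C[k+1] n s ⟩
  suc n C suc s ∎
  where open ≡-Reasoning

∈-subsetsOfSize : ∀ {s} (p : Subset n) → ∣ p ∣ ≡ s → p ∈ₗ subsetsOfSize n s
∈-subsetsOfSize {s = zero} [] _ = here refl
∈-subsetsOfSize {s = zero} (outside ∷ p) ∣p∣≡0 = ∈-map⁺ (outside ∷_) (∈-subsetsOfSize p ∣p∣≡0)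
∈-subsetsOfSize {s = suc s} (outside ∷ p) ∣p∣≡1+s =
  ∈-++⁺ˡ (∈-map⁺ (outside ∷_) (∈-subsetsOfSize p ∣p∣≡1+s))
∈-subsetsOfSize {s = suc s} (inside ∷ p) ∣p∣≡s =
  ∈-++⁺ʳ _ (∈-map⁺ (inside ∷_) (∈-subsetsOfSize p (suc-injective ∣p∣≡s)))

∃-superset-of-size : (A : Subset k) (m : ℕ) → ∣ A ∣ + m ≤ k → ∃ λ B → A ⊆ B × ∣ B ∣ ≡ ∣ A ∣ + m
∃-superset-of-size A zero _ = A , id , sym (+-identityʳ ∣ A ∣)
∃-superset-of-size (inside ∷ A) m (s≤s ∣A∣+m≤k)
  with B , A⊆B , ∣B∣≡∣A∣+m ← ∃-superset-of-size A m ∣A∣+m≤k =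
  inside ∷ B , s⊆s A⊆B , cong suc ∣B∣≡∣A∣+m
∃-superset-of-size {suc k} (outside ∷ A) (suc m) ∣A∣+1+m≤1+k
  with B , A⊆B , ∣B∣≡∣A∣+m ← ∃-superset-of-size A m
         (≤-pred (subst (_≤ suc k) (+-suc ∣ A ∣ m) ∣A∣+1+m≤1+k)) =
  inside ∷ B , out⊆ A⊆B , trans (cong suc ∣B∣≡∣A∣+m) (sym (+-suc ∣ A ∣ m))

Unique⇒lookup-injective : ∀ {a} {A : Set a} {xs : List A} → Unique xs →
  ∀ {i j : Fin (length xs)} → i <ᶠ j → List.lookup xs i ≢ List.lookup xs j
Unique⇒lookup-injective (x∉xs ∷ _) {zero} {suc j} _ = All.lookup x∉xs (∈-lookup j)
Unique⇒lookup-injective (_ ∷ xs!) {suc i} {suc j} (s≤s i<j) = Unique⇒lookup-injective xs! i<j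

pigeonhole-∈ : ∀ {a b} {A : Set a} {B : Set b} (f : A → B) {xs : List A} {ys : List B} →
  Unique xs → (∀ {x} → x ∈ₗ xs → f x ∈ₗ ys) → length ys < length xs →
  ∃₂ λ x y → x ∈ₗ xs × y ∈ₗ xs × x ≢ y × f x ≡ f y
pigeonhole-∈ f {xs} {ys} xs! f∈ys ∣ys∣<∣xs∣
  with i , j , i<j , slot[i]≡slot[j] ← pigeonhole ∣ys∣<∣xs∣ (index ∘ f∈ys ∘ ∈-lookup) =
  List.lookup xs i , List.lookup xs j , ∈-lookup i , ∈-lookup j ,
  Unique⇒lookup-injective xs! i<j , (begin
    f (List.lookup xs i)           ≡⟨ lookup-index (f∈ys (∈-lookup i)) ⟩
    List.lookup ys (slot i)        ≡⟨ cong (List.lookup ys) slot[i]≡slot[j] ⟩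
    List.lookup ys (slot j)        ≡⟨ lookup-index (f∈ys (∈-lookup j)) ⟨
    f (List.lookup xs j)           ∎)
  where
  open ≡-Reasoning
  slot : Fin (length xs) → Fin (length ys)
  slot = index ∘ f∈ys ∘ ∈-lookup

RankAtLeast-mono : ∀ {𝓜 : Subset k → Set} {m m′} → RankAtLeast 𝓜 m → m′ ≤ m → RankAtLeast 𝓜 m′
RankAtLeast-mono rank m′≤m A 1+∣A∣≤m′ = rank A (≤-trans 1+∣A∣≤m′ m′≤m)

CoveredBy-⊆ : ∀ {𝓜 : Subset k → Set} {A B} → A ⊆ B → CoveredBy 𝓜 B → CoveredBy 𝓜 A
CoveredBy-⊆ A⊆B (M , M∈𝓜 , M≢⊤ , B⊆M) = M , M∈𝓜 , M≢⊤ , ⊆-trans A⊆B B⊆M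

CoveredBy-Int : ∀ {s} (p : Fin n → Fin k) {𝓕 : List (Subset n)} →
  Unique 𝓕 → All (KPartiteSet p) 𝓕 → n C s < length 𝓕 →
  (B : Subset k) → ∣ B ∣ ≡ s → CoveredBy (InInt p 𝓕) B
CoveredBy-Int {n} {s = s} p {𝓕} 𝓕! kp n[C]s<∣𝓕∣ B ∣B∣≡s =
  let E , F , E∈𝓕 , F∈𝓕 , E≢F , traces≡ =
        pigeonhole-∈ (λ F → F ∩ preimage p B) 𝓕! trace∈ ∣subsets∣<∣𝓕∣ in
  π p (E ∩ F) , (E , F , E∈𝓕 , F∈𝓕 , E≢F , refl) ,
  π[E∩F]≢⊤ p (All.lookup kp E∈𝓕) (All.lookup kp F∈𝓕) E≢F ,
  equal-traces⇒B⊆π[E∩F] p (All.lookup kp E∈𝓕) traces≡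
  where
  trace∈ : ∀ {F} → F ∈ₗ 𝓕 → F ∩ preimage p B ∈ₗ subsetsOfSize n s
  trace∈ {F} F∈𝓕 = ∈-subsetsOfSize _ (trans (∣F∩preimage∣≡∣B∣ p {F} (All.lookup kp F∈𝓕) B) ∣B∣≡s)
  ∣subsets∣<∣𝓕∣ : length (subsetsOfSize n s) < length 𝓕
  ∣subsets∣<∣𝓕∣ = subst (_< length 𝓕) (sym (length-subsetsOfSize n s)) n[C]s<∣𝓕∣

RankAtLeast-Int : ∀ {s} (p : Fin n → Fin k) {𝓕 : List (Subset n)} → s ≤ k →
  Unique 𝓕 → All (KPartiteSet p) 𝓕 → n C s < length 𝓕 → RankAtLeast (InInt p 𝓕) (suc s)
RankAtLeast-Int {s = s} p s≤k 𝓕! kp n[C]s<∣𝓕∣ A (s≤s ∣A∣≤s) =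
  let B , A⊆B , ∣B∣≡∣A∣+[s∸∣A∣] = ∃-superset-of-size A (s ∸ ∣ A ∣) ∣A∣+[s∸∣A∣]≤k
  in CoveredBy-⊆ A⊆B (CoveredBy-Int p 𝓕! kp n[C]s<∣𝓕∣ B (trans ∣B∣≡∣A∣+[s∸∣A∣] ∣A∣+[s∸∣A∣]≡s))
  where
  ∣A∣+[s∸∣A∣]≡s : ∣ A ∣ + (s ∸ ∣ A ∣) ≡ s
  ∣A∣+[s∸∣A∣]≡s = m+[n∸m]≡n ∣A∣≤s
  ∣A∣+[s∸∣A∣]≤k : ∣ A ∣ + (s ∸ ∣ A ∣) ≤ _
  ∣A∣+[s∸∣A∣]≤k = subst (_≤ _) (sym ∣A∣+[s∸∣A∣]≡s) s≤k

claim11 : (n k t : ℕ) → .{{NonZero n}} → .{{NonZero k}} → .{{NonZero t}} → t < k →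
    (part : Fin n → Fin k) →
    (𝓕 : List (Subset n)) → Unique 𝓕 → All (KPartiteSet part) 𝓕 →
    binomShift n k t < length 𝓕 →
    RankAtLeast (InInt part 𝓕) (k ∸ t ∸ 1)
-- Splitting on the test inside binomShift turns big into n C (k ∸ t ∸ 2) < length 𝓕.
claim11 n k t _ part 𝓕 𝓕! kp big with suc (suc t) ≤? k
... | yes _ = RankAtLeast-mono (RankAtLeast-Int part s≤k 𝓕! kp big) k∸t∸1≤1+s
  where
  s≤k : k ∸ t ∸ 2 ≤ k
  s≤k = ≤-trans (m∸n≤m (k ∸ t) 2) (m∸n≤m k t)
  k∸t∸1≤1+s : k ∸ t ∸ 1 ≤ suc (k ∸ t ∸ 2)
  k∸t∸1≤1+s = ∸-monoˡ-≤ 1 (m≤n+m∸n (k ∸ t) 2)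
... | no 2+t≰k = RankAtLeast-mono (λ _ ()) (∸-monoˡ-≤ 1 k∸t≤1)
  where
  k∸t≤1 : k ∸ t ≤ 1
  k∸t≤1 = ≤-trans (∸-monoˡ-≤ t (≤-pred (≰⇒> 2+t≰k))) (≤-reflexive (m+n∸n≡m 1 t))
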